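{- Let $t$ and $t'$ be two $(k,n)$-tuples that differ in exactly two elements (as multisets of entries) and such that $t<t'$ lexicographically. Then $t'$ is a $2$-change of $t$.
   Context: For positive integers $k,n\ge 2$, a $(k,n)$-tuple is a $k$-tuple $t=(t[1],\dots,t[k])$ of non-negative integers sorted in nondecreasing order with $\sum_i t[i]=n$. $t<t'$ means there is $j$ with $t[j]<t'[j]$ and $t[i]=t'[i]$ for all $i<j$. For $x<y$ in $\{1,\dots,k\}$ with $t[x]+2\le t[y]$ and $\delta\in\{1,\dots,t[y]-t[x]-1\}$, an $(x,y)$-change of $t$ of order $\delta$ is the $(k,n)$-tuple whose entries are exactly the multiset $\{t[i]: i\ne x,y\}\cup\{t[x]+\delta,\,t[y]-\delta\}$ (sorted nondecreasingly). A $2$-change of $t$ (of order $\delta$) is an $(x,y)$-change of $t$ of order $\delta$ for some such $x<y$. -}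

module Defs where

open import Data.Nat using (ℕ; _+_; _∸_; _≤_; _<_)
open import Data.Fin using (Fin; toℕ)
import Data.Fin as F
open import Data.List using (List; _∷_; tabulate)
open import Data.Nat.ListAction using (sum)
open import Data.List.Relation.Binary.Permutation.Propositional using (_↭_)
open import Data.Product using (Σ; _×_; ∃; ∃-syntax)
open import Relation.Binary.PropositionalEquality using (_≡_; _≢_)

-- A k-tuple of naturals, indexed by Fin k (t i is the paper's t[i+1]).
Tup : ℕ → Set
Tup k = Fin k → ℕ

entries : ∀ {k} → Tup k → List ℕ
entries t = tabulate t

IsTuple : (k n : ℕ) → Tup k → Set
IsTuple k n t = (∀ (i j : Fin k) → i F.≤ j → t i ≤ t j) × sum (entries t) ≡ n

_<lex_ : ∀ {k} → Tup k → Tup k → Set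
t <lex t' = ∃[ j ] (t j < t' j × (∀ i → i F.< j → t i ≡ t' i))

-- t and t' differ in exactly two elements as multisets:
-- entries t = {a,b} ⊎ r and entries t' = {c,d} ⊎ r (as multisets),
-- with {a,b} and {c,d} disjoint (so the multiset difference has size exactly 2).
DifferInTwo : ∀ {k} → Tup k → Tup k → Set
DifferInTwo t t' =
  Σ ℕ λ a → Σ ℕ λ b → Σ ℕ λ c → Σ ℕ λ d → Σ (List ℕ) λ r →
    (entries t ↭ a ∷ b ∷ r) × (entries t' ↭ c ∷ d ∷ r) ×
    (a ≢ c) × (a ≢ d) × (b ≢ c) × (b ≢ d)

-- t' is an (x,y)-change of t of order δ (t' assumed to be a (k,n)-tuple,
-- i.e. already sorted): x < y, t[x]+2 ≤ t[y], 1 ≤ δ ≤ t[y]-t[x]-1, and the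
-- entries of t' are exactly {t[i] : i ≠ x,y} ∪ {t[x]+δ, t[y]-δ}.
-- The multiset {t[i] : i ≠ x,y} is the list r with entries t ↭ t[x] ∷ t[y] ∷ r.
XYChange : ∀ {k} → Tup k → (x y : Fin k) → (δ : ℕ) → Tup k → Set
XYChange t x y δ t' =
  x F.< y × t x + 2 ≤ t y × 1 ≤ δ × δ ≤ t y ∸ t x ∸ 1 ×
  Σ (List ℕ) λ r → (entries t ↭ t x ∷ t y ∷ r) ×
                   (entries t' ↭ (t x + δ) ∷ (t y ∸ δ) ∷ r)

TwoChange : ∀ {k} → Tup k → Tup k → Set
TwoChange t t' = ∃[ x ] ∃[ y ] ∃[ δ ] XYChange t x y δ t'

-- Let #≤ w count the entries that are at most w.  For sorted tuples t <lex t' means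
-- that, at the first threshold where the counts differ, t has more entries.  Write the
-- differing pairs as a ≤ b in t and c ≤ d in t'.  If c < a, then t' has at least as
-- many entries as t up to every threshold w ≤ c, and strictly more up to c, contradicting
-- t <lex t'; hence a < c, and equality of the sums gives a < c ≤ d < b, so t' is the
-- (a,b)-change of t of order c − a.
module Submission where

open import Defs
open import Data.Nat using (ℕ; zero; suc; _+_; _∸_; _≤_; _<_; _≤?_; _<?_; _⊓_; _⊔_; s≤s)
open import Data.Nat.Properties
open import Data.Fin using (Fin; toℕ)
import Data.Fin as F
open import Data.List using (List; _∷_; length; filter)
open import Data.List.Properties using (filter-accept; filter-reject)
open import Data.Nat.ListAction using (sum)
open import Data.Nat.ListAction.Properties using (sum-↭)
open import Data.List.Relation.Binary.Permutation.Propositional using (_↭_; ↭-refl; ↭-sym; ↭-trans; swap)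
open import Data.List.Relation.Binary.Permutation.Propositional.Properties using (↭-length; filter-↭; ∈-resp-↭)
open import Data.List.Membership.Propositional.Properties using (∈-tabulate⁻)
open import Data.List.Relation.Unary.Any using (here; there)
open import Data.Product using (_×_; ∃; _,_)
open import Data.Sum using (_⊎_; inj₁; inj₂)
open import Function using (_∘_)
open import Relation.Nullary using (¬_; yes; no; contradiction)
open import Relation.Binary.PropositionalEquality

Sorted : ∀ {k} → Tup k → Set
Sorted {k} t = ∀ (i j : Fin k) → i F.≤ j → t i ≤ t j

sorted-reflects-< : ∀ {k} {t : Tup k} → Sorted t → ∀ {i j} → t i < t j → i F.< j
sorted-reflects-< st {i} {j} ti<tj with toℕ i <? toℕ j
... | yes i<j = i<j
... | no i≮j = contradiction (st j i (≮⇒≥ i≮j)) (<⇒≱ ti<tj)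

#≤ : ℕ → List ℕ → ℕ
#≤ w xs = length (filter (_≤? w) xs)

#≤-↭ : ∀ w {xs ys} → xs ↭ ys → #≤ w xs ≡ #≤ w ys
#≤-↭ w = ↭-length ∘ filter-↭ (_≤? w)

#≤-∷-≤ : ∀ {w x} xs → x ≤ w → #≤ w (x ∷ xs) ≡ suc (#≤ w xs)
#≤-∷-≤ {w} _ x≤w = cong length (filter-accept (_≤? w) x≤w)

#≤-∷-> : ∀ {w x} xs → w < x → #≤ w (x ∷ xs) ≡ #≤ w xs
#≤-∷-> {w} _ w<x = cong length (filter-reject (_≤? w) (<⇒≱ w<x))

#≤-∷ : ∀ w x xs → #≤ w xs ≤ #≤ w (x ∷ xs)
#≤-∷ w x xs with x ≤? w
... | yes x≤w = ≤-trans (n≤1+n _) (≤-reflexive (sym (#≤-∷-≤ xs x≤w)))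
... | no x≰w = ≤-reflexive (sym (#≤-∷-> xs (≰⇒> x≰w)))

#≤-∷-mono : ∀ w {x y} xs ys → (x ≤ w → y ≤ w) →
            #≤ w xs ≤ #≤ w ys → #≤ w (x ∷ xs) ≤ #≤ w (y ∷ ys)
#≤-∷-mono w {x} {y} xs ys x⇒y le with x ≤? w
... | yes x≤w rewrite #≤-∷-≤ xs x≤w | #≤-∷-≤ ys (x⇒y x≤w) = s≤s le
... | no x≰w rewrite #≤-∷-> xs (≰⇒> x≰w) = ≤-trans le (#≤-∷ w y ys)

#≤-∷-mono-< : ∀ w {x y} xs ys → (x ≤ w → y ≤ w) →
              #≤ w xs < #≤ w ys → #≤ w (x ∷ xs) < #≤ w (y ∷ ys)
#≤-∷-mono-< w {x} {y} xs ys x⇒y lt with x ≤? w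
... | yes x≤w rewrite #≤-∷-≤ xs x≤w | #≤-∷-≤ ys (x⇒y x≤w) = s≤s lt
... | no x≰w rewrite #≤-∷-> xs (≰⇒> x≰w) = <-≤-trans lt (#≤-∷ w y ys)

#≤-mono : ∀ {k} w (f g : Tup k) → (∀ i → f i ≤ w → g i ≤ w) →
          #≤ w (entries f) ≤ #≤ w (entries g)
#≤-mono {zero} w f g f⇒g = ≤-refl
#≤-mono {suc k} w f g f⇒g =
  #≤-∷-mono w _ _ (f⇒g F.zero) (#≤-mono w (f ∘ F.suc) (g ∘ F.suc) (f⇒g ∘ F.suc))

#≤-mono-< : ∀ {k} w (f g : Tup k) → (∀ i → f i ≤ w → g i ≤ w) →
            ∀ j → w < f j → g j ≤ w → #≤ w (entries f) < #≤ w (entries g)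
#≤-mono-< w f g f⇒g F.zero f₀>w g₀≤w
  rewrite #≤-∷-> (entries (f ∘ F.suc)) f₀>w | #≤-∷-≤ (entries (g ∘ F.suc)) g₀≤w =
  s≤s (#≤-mono w (f ∘ F.suc) (g ∘ F.suc) (f⇒g ∘ F.suc))
#≤-mono-< w f g f⇒g (F.suc j) fⱼ>w gⱼ≤w =
  #≤-∷-mono-< w _ _ (f⇒g F.zero) (#≤-mono-< w (f ∘ F.suc) (g ∘ F.suc) (f⇒g ∘ F.suc) j fⱼ>w gⱼ≤w)

<lex⇒#≤ : ∀ {k} {t t' : Tup k} → Sorted t → Sorted t' → t <lex t' →
          ∃ λ v → (∀ w → w < v → #≤ w (entries t) ≡ #≤ w (entries t')) ×
                  #≤ v (entries t') < #≤ v (entries t)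
<lex⇒#≤ {t = t} {t'} st st' (j , tⱼ<t'ⱼ , prefix) = t j , agree , drop
  where
  before-or-from : ∀ i → t i ≡ t' i ⊎ (t j ≤ t i × t' j ≤ t' i)
  before-or-from i with toℕ i <? toℕ j
  ... | yes i<j = inj₁ (prefix i i<j)
  ... | no i≮j = inj₂ (st j i (≮⇒≥ i≮j) , st' j i (≮⇒≥ i≮j))

  agree : ∀ w → w < t j → #≤ w (entries t) ≡ #≤ w (entries t')
  agree w w<tⱼ = ≤-antisym (#≤-mono w t t' t⇒t') (#≤-mono w t' t t'⇒t)
    where
    t⇒t' : ∀ i → t i ≤ w → t' i ≤ w
    t⇒t' i tᵢ≤w with before-or-from i
    ... | inj₁ tᵢ≡t'ᵢ = subst (_≤ w) tᵢ≡t'ᵢ tᵢ≤w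
    ... | inj₂ (tⱼ≤tᵢ , _) = contradiction (≤-trans tⱼ≤tᵢ tᵢ≤w) (<⇒≱ w<tⱼ)
    t'⇒t : ∀ i → t' i ≤ w → t i ≤ w
    t'⇒t i t'ᵢ≤w with before-or-from i
    ... | inj₁ tᵢ≡t'ᵢ = subst (_≤ w) (sym tᵢ≡t'ᵢ) t'ᵢ≤w
    ... | inj₂ (_ , t'ⱼ≤t'ᵢ) = contradiction (≤-trans t'ⱼ≤t'ᵢ t'ᵢ≤w) (<⇒≱ (<-trans w<tⱼ tⱼ<t'ⱼ))

  drop : #≤ (t j) (entries t') < #≤ (t j) (entries t)
  drop = #≤-mono-< (t j) t' t t'⇒t j tⱼ<t'ⱼ ≤-refl
    where
    t'⇒t : ∀ i → t' i ≤ t j → t i ≤ t j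
    t'⇒t i t'ᵢ≤tⱼ with before-or-from i
    ... | inj₁ tᵢ≡t'ᵢ = subst (_≤ t j) (sym tᵢ≡t'ᵢ) t'ᵢ≤tⱼ
    ... | inj₂ (_ , t'ⱼ≤t'ᵢ) = contradiction (≤-trans t'ⱼ≤t'ᵢ t'ᵢ≤tⱼ) (<⇒≱ tⱼ<t'ⱼ)

#≤-dominated⇒¬<lex : ∀ {k} {t t' : Tup k} → Sorted t → Sorted t' → ∀ c →
                     (∀ w → w ≤ c → #≤ w (entries t) ≤ #≤ w (entries t')) →
                     #≤ c (entries t) < #≤ c (entries t') → ¬ t <lex t'
#≤-dominated⇒¬<lex st st' c dominated more lx with <lex⇒#≤ st st' lx
... | v , agree , drop with c <? v
...   | yes c<v = <-irrefl (agree c c<v) more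
...   | no c≮v = <⇒≱ drop (dominated v (≮⇒≥ c≮v))

#≤-below-pair : ∀ {w a b} r → w < a → w < b → #≤ w (a ∷ b ∷ r) ≡ #≤ w r
#≤-below-pair {b = b} r w<a w<b = trans (#≤-∷-> (b ∷ r) w<a) (#≤-∷-> r w<b)

lower-pair⇒¬<lex : ∀ {k} {t t' : Tup k} {a b c d r} → Sorted t → Sorted t' →
                   entries t ↭ a ∷ b ∷ r → entries t' ↭ c ∷ d ∷ r →
                   c < a → c < b → ¬ t <lex t'
lower-pair⇒¬<lex {t = t} {t'} {a} {b} {c} {d} {r} st st' t↭ t'↭ c<a c<b =
  #≤-dominated⇒¬<lex st st' c dominated more
  where
  open ≤-Reasoning
  dominated : ∀ w → w ≤ c → #≤ w (entries t) ≤ #≤ w (entries t')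
  dominated w w≤c = begin
    #≤ w (entries t)  ≡⟨ #≤-↭ w t↭ ⟩
    #≤ w (a ∷ b ∷ r)  ≡⟨ #≤-below-pair r (≤-<-trans w≤c c<a) (≤-<-trans w≤c c<b) ⟩
    #≤ w r            ≤⟨ #≤-∷ w d r ⟩
    #≤ w (d ∷ r)      ≤⟨ #≤-∷ w c (d ∷ r) ⟩
    #≤ w (c ∷ d ∷ r)  ≡⟨ #≤-↭ w (↭-sym t'↭) ⟩
    #≤ w (entries t') ∎
  more : #≤ c (entries t) < #≤ c (entries t')
  more = begin-strict
    #≤ c (entries t)  ≡⟨ #≤-↭ c t↭ ⟩
    #≤ c (a ∷ b ∷ r)  ≡⟨ #≤-below-pair r c<a c<b ⟩
    #≤ c r            ≤⟨ #≤-∷ c d r ⟩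
    #≤ c (d ∷ r)      <⟨ n<1+n _ ⟩
    suc (#≤ c (d ∷ r)) ≡⟨ #≤-∷-≤ (d ∷ r) ≤-refl ⟨
    #≤ c (c ∷ d ∷ r)  ≡⟨ #≤-↭ c (↭-sym t'↭) ⟩
    #≤ c (entries t') ∎

m+n≡o+p⇒n∸[o∸m]≡p : ∀ {m n o p} → m + n ≡ o + p → m ≤ o → n ∸ (o ∸ m) ≡ p
m+n≡o+p⇒n∸[o∸m]≡p {m} {n} {o} {p} eq m≤o = begin
  n ∸ (o ∸ m)             ≡⟨ cong (_∸ (o ∸ m)) n≡[o∸m]+p ⟩
  (o ∸ m) + p ∸ (o ∸ m)   ≡⟨ m+n∸m≡n (o ∸ m) p ⟩
  p                       ∎
  where
  open ≡-Reasoning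
  n≡[o∸m]+p : n ≡ (o ∸ m) + p
  n≡[o∸m]+p = +-cancelˡ-≡ m n ((o ∸ m) + p) (begin
    m + n               ≡⟨ eq ⟩
    o + p               ≡⟨ cong (_+ p) (m+[n∸m]≡n m≤o) ⟨
    m + (o ∸ m) + p     ≡⟨ +-assoc m (o ∸ m) p ⟩
    m + ((o ∸ m) + p)   ∎)

↭-pair-sum : ∀ {xs ys a b c d r} → sum xs ≡ sum ys →
             xs ↭ a ∷ b ∷ r → ys ↭ c ∷ d ∷ r → a + b ≡ c + d
↭-pair-sum {xs} {ys} {a} {b} {c} {d} {r} Σxs≡Σys xs↭ ys↭ =
  +-cancelʳ-≡ (sum r) (a + b) (c + d) (begin
    a + b + sum r     ≡⟨ +-assoc a b (sum r) ⟩
    a + (b + sum r)   ≡⟨ sum-↭ xs↭ ⟨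
    sum xs            ≡⟨ Σxs≡Σys ⟩
    sum ys            ≡⟨ sum-↭ ys↭ ⟩
    c + (d + sum r)   ≡⟨ +-assoc c d (sum r) ⟨
    c + d + sum r     ∎)
  where open ≡-Reasoning

nested-pair⇒TwoChange : ∀ {k} {t t' : Tup k} {a b c d r} → Sorted t →
                        entries t ↭ a ∷ b ∷ r → entries t' ↭ c ∷ d ∷ r →
                        a < c → c ≤ d → d < b → a + b ≡ c + d → TwoChange t t'
nested-pair⇒TwoChange {t = t} {t'} {a} {b} {c} {d} {r} st t↭ t'↭ a<c c≤d d<b a+b≡c+d
  with ∈-tabulate⁻ (∈-resp-↭ (↭-sym t↭) (here refl))
     | ∈-tabulate⁻ (∈-resp-↭ (↭-sym t↭) (there (here refl)))
... | x , refl | y , refl =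
  x , y , c ∸ a , sorted-reflects-< st a<b , a+2≤b , m<n⇒0<n∸m a<c , δ≤b∸a∸1 ,
  r , t↭ , subst₂ (λ u v → entries t' ↭ u ∷ v ∷ r)
                  (sym (m+[n∸m]≡n (<⇒≤ a<c))) (sym (m+n≡o+p⇒n∸[o∸m]≡p a+b≡c+d (<⇒≤ a<c))) t'↭
  where
  c<b : c < b
  c<b = ≤-<-trans c≤d d<b
  a<b : a < b
  a<b = <-trans a<c c<b
  a+2≤b : a + 2 ≤ b
  a+2≤b = ≤-trans (≤-reflexive (+-comm a 2)) (≤-trans (s≤s a<c) c<b)
  δ≤b∸a∸1 : c ∸ a ≤ b ∸ a ∸ 1
  δ≤b∸a∸1 = ∸-monoˡ-≤ 1 (∸-monoˡ-< c<b (<⇒≤ a<c))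

ordered-pairs⇒TwoChange : ∀ {k} {t t' : Tup k} {a b c d r} → Sorted t → Sorted t' →
                          sum (entries t) ≡ sum (entries t') →
                          entries t ↭ a ∷ b ∷ r → entries t' ↭ c ∷ d ∷ r →
                          a ≤ b → c ≤ d → a ≢ c → t <lex t' → TwoChange t t'
ordered-pairs⇒TwoChange {a = a} {b} {c} {d} st st' Σt≡Σt' t↭ t'↭ a≤b c≤d a≢c lx =
  nested-pair⇒TwoChange st t↭ t'↭ a<c c≤d d<b a+b≡c+d
  where
  a+b≡c+d : a + b ≡ c + d
  a+b≡c+d = ↭-pair-sum Σt≡Σt' t↭ t'↭
  a<c : a < c
  a<c with c <? a
  ... | yes c<a = contradiction lx (lower-pair⇒¬<lex st st' t↭ t'↭ c<a (<-≤-trans c<a a≤b))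
  ... | no c≮a = ≤∧≢⇒< (≮⇒≥ c≮a) a≢c
  d<b : d < b
  d<b with b ≤? d
  ... | yes b≤d = contradiction a+b≡c+d (<⇒≢ (+-mono-<-≤ a<c b≤d))
  ... | no b≰d = ≰⇒> b≰d

↭-⊓-⊔ : ∀ {xs a b r} → xs ↭ a ∷ b ∷ r → xs ↭ a ⊓ b ∷ a ⊔ b ∷ r
↭-⊓-⊔ {a = a} {b} xs↭ with ≤-total a b
... | inj₁ a≤b rewrite m≤n⇒m⊓n≡m a≤b | m≤n⇒m⊔n≡n a≤b = xs↭
... | inj₂ b≤a rewrite m≥n⇒m⊓n≡n b≤a | m≥n⇒m⊔n≡m b≤a = ↭-trans xs↭ (swap a b ↭-refl)

⊓≢⊓ : ∀ {a b c d} → a ≢ c → a ≢ d → b ≢ c → b ≢ d → a ⊓ b ≢ c ⊓ d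
⊓≢⊓ {a} {b} {c} {d} a≢c a≢d b≢c b≢d with ⊓-sel a b | ⊓-sel c d
... | inj₁ eq₁ | inj₁ eq₂ rewrite eq₁ | eq₂ = a≢c
... | inj₁ eq₁ | inj₂ eq₂ rewrite eq₁ | eq₂ = a≢d
... | inj₂ eq₁ | inj₁ eq₂ rewrite eq₁ | eq₂ = b≢c
... | inj₂ eq₁ | inj₂ eq₂ rewrite eq₁ | eq₂ = b≢d

lemma3 : (k n : ℕ) → 2 ≤ k → 2 ≤ n → (t t' : Tup k) →
         IsTuple k n t → IsTuple k n t' →
         DifferInTwo t t' → t <lex t' → TwoChange t t'
lemma3 k n _ _ t t' (st , Σt≡n) (st' , Σt'≡n)
       (a , b , c , d , r , t↭ , t'↭ , a≢c , a≢d , b≢c , b≢d) lx =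
  ordered-pairs⇒TwoChange st st' (trans Σt≡n (sym Σt'≡n))
    (↭-⊓-⊔ t↭) (↭-⊓-⊔ t'↭) (m⊓n≤m⊔n a b) (m⊓n≤m⊔n c d) (⊓≢⊓ a≢c a≢d b≢c b≢d) lx
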